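{- The following two rules are admissible in access Hoare logic, for every program $C$ and assertions $P_1,P_2,Q_1,Q_2$: (conjunction) if $\langle P_1\rangle\,C\,\langle Q_1\rangle$ and $\langle P_2\rangle\,C\,\langle Q_2\rangle$ are provable, then $\langle P_1\wedge P_2\rangle\,C\,\langle Q_1\wedge Q_2\rangle$ is provable; (disjunction) if $\langle P_1\rangle\,C\,\langle Q_1\rangle$ and $\langle P_2\rangle\,C\,\langle Q_2\rangle$ are provable, then $\langle P_1\vee P_2\rangle\,C\,\langle Q_1\vee Q_2\rangle$ is provable.
   Context: States are mappings from variables to values; assertions are arbitrary predicates on states. Programs of the while language are built from $\mathtt{skip}$, assignments $V:=E$ ($V$ a variable, $E$ a side-effect-free expression possibly containing $V$), sequential composition $S;T$, $\mathtt{if}\ B\ \mathtt{then}\ S\ \mathtt{else}\ T$ and $\mathtt{while}\ B\ \mathtt{do}\ S$ ($B$ a boolean condition), with the standard deterministic big-step execution relation $C:s\Rightarrow s'$. Access Hoare logic is the calculus for triples $\langle P\rangle\,C\,\langle Q\rangle$ with the following axioms and rules: (skip) $\langle P\rangle\,\mathtt{skip}\,\langle P\rangle$; (assignment) $\langle P[E/V]\rangle\,V:=E\,\langle P\rangle$, where $P[E/V]$ replaces free occurrences of $V$ in $P$ by $E$; (consequence) from $P_2\rightarrow P_1$ (valid implication), $\langle P_2\rangle\,S\,\langle Q_2\rangle$ and $Q_1\rightarrow Q_2$ (valid implication) infer $\langle P_1\rangle\,S\,\langle Q_1\rangle$; (composition) from $\langle P\rangle\,S\,\langle R\rangle$ and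 $\langle R\rangle\,T\,\langle Q\rangle$ infer $\langle P\rangle\,S;T\,\langle Q\rangle$; (conditional) from $\langle B\rightarrow P\rangle\,S\,\langle Q\rangle$ and $\langle \neg B\rightarrow P\rangle\,T\,\langle Q\rangle$ infer $\langle P\rangle\,\mathtt{if}\ B\ \mathtt{then}\ S\ \mathtt{else}\ T\,\langle Q\rangle$; (while) from $\langle B\rightarrow P\rangle\,S\,\langle P\rangle$ infer $\langle P\rangle\,\mathtt{while}\ B\ \mathtt{do}\ S\,\langle \neg B\rightarrow P\rangle$. A rule is admissible if whenever its premises are provable, so is its conclusion. -}

module Defs where

open import Data.Bool using (Bool; true; false)
open import Data.Product using (_×_)
open import Data.Sum using (_⊎_)
open import Relation.Binary.Definitions using (DecidableEquality)
open import Relation.Binary.PropositionalEquality using (_≡_)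
open import Relation.Nullary using (¬_; does)

module Lang (Var : Set) (_≟_ : DecidableEquality Var) (Val : Set) where

  State : Set
  State = Var → Val

  Expr : Set
  Expr = State → Val

  BExp : Set
  BExp = State → Bool

  Assn : Set₁
  Assn = State → Set

  update : State → Var → Val → State
  update s V v W with does (W ≟ V)
  ... | true = v
  ... | false = s W

  data Cmd : Set where
    skip  : Cmd
    _:=_  : Var → Expr → Cmd
    _⨾_  : Cmd → Cmd → Cmd
    if_then_else_ : BExp → Cmd → Cmd → Cmd
    while_loop_ : BExp → Cmd → Cmd

  _[_/_] : Assn → Expr → Var → Assn
  (P [ E / V ]) s = P (update s V (E s))

  _⇒_ : Assn → Assn → Set
  P ⇒ Q = ∀ s → P s → Q s

  _∧ₐ_ : Assn → Assn → Assn
  (P ∧ₐ Q) s = P s × Q s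

  _∨ₐ_ : Assn → Assn → Assn
  (P ∨ₐ Q) s = P s ⊎ Q s

  _→ₐ_ : BExp → Assn → Assn
  (B →ₐ P) s = B s ≡ true → P s

  ¬ₐ_→ₐ_ : BExp → Assn → Assn
  (¬ₐ B →ₐ P) s = ¬ (B s ≡ true) → P s

  data ⟨_⟩_⟨_⟩ : Assn → Cmd → Assn → Set₁ where
    h-skip : ∀ {P} → ⟨ P ⟩ skip ⟨ P ⟩
    h-assign : ∀ {P V E} → ⟨ P [ E / V ] ⟩ (V := E) ⟨ P ⟩
    h-conseq : ∀ {P₁ P₂ Q₁ Q₂ S} → P₂ ⇒ P₁ → ⟨ P₂ ⟩ S ⟨ Q₂ ⟩ → Q₁ ⇒ Q₂
             → ⟨ P₁ ⟩ S ⟨ Q₁ ⟩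
    h-comp : ∀ {P R Q S T} → ⟨ P ⟩ S ⟨ R ⟩ → ⟨ R ⟩ T ⟨ Q ⟩ → ⟨ P ⟩ (S ⨾ T) ⟨ Q ⟩
    h-if : ∀ {P Q B S T} → ⟨ B →ₐ P ⟩ S ⟨ Q ⟩ → ⟨ ¬ₐ B →ₐ P ⟩ T ⟨ Q ⟩
         → ⟨ P ⟩ (if B then S else T) ⟨ Q ⟩
    h-while : ∀ {P B S} → ⟨ B →ₐ P ⟩ S ⟨ P ⟩ → ⟨ P ⟩ (while B loop S) ⟨ ¬ₐ B →ₐ P ⟩

-- A derivation of ⟨ P ⟩ C ⟨ Q ⟩ can be inverted along the syntax of C into
-- derivations for its components, up to consequence: for a loop this yields
-- an invariant I with I ⇒ P and Q ⇒ (¬B → I).  Two derivations for the same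
-- C are thus combined by structural induction on C, taking the pointwise
-- combination of the two intermediate assertions (resp. invariants) at each
-- step.  This works for any pointwise connective that is monotone in both
-- arguments and distributes over implication from a fixed hypothesis, which
-- covers both ∧ and ∨.
module Submission where

open import Defs
open import Data.Product as Product using (_×_; _,_; Σ-syntax)
open import Data.Sum as Sum using (_⊎_; inj₁; inj₂)
open import Relation.Binary.Definitions using (DecidableEquality)

module Admissibility (Var : Set) (_≟_ : DecidableEquality Var) (Val : Set) where
  open Lang Var _≟_ Val

  weaken-pre : ∀ {P P′ Q S} → P′ ⇒ P → ⟨ P′ ⟩ S ⟨ Q ⟩ → ⟨ P ⟩ S ⟨ Q ⟩
  weaken-pre P′⇒P d = h-conseq P′⇒P d (λ _ q → q)

  strengthen-post : ∀ {P Q Q′ S} → ⟨ P ⟩ S ⟨ Q′ ⟩ → Q ⇒ Q′ → ⟨ P ⟩ S ⟨ Q ⟩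
  strengthen-post d Q⇒Q′ = h-conseq (λ _ p → p) d Q⇒Q′

  skip-inv : ∀ {P Q} → ⟨ P ⟩ skip ⟨ Q ⟩ → Q ⇒ P
  skip-inv h-skip                  s q = q
  skip-inv (h-conseq P′⇒P d Q⇒Q′) s q = P′⇒P s (skip-inv d s (Q⇒Q′ s q))

  assign-inv : ∀ {P Q V E} → ⟨ P ⟩ (V := E) ⟨ Q ⟩ → (Q [ E / V ]) ⇒ P
  assign-inv h-assign                 s q = q
  assign-inv (h-conseq P′⇒P d Q⇒Q′) s q = P′⇒P s (assign-inv d s (Q⇒Q′ _ q))

  comp-inv : ∀ {P Q S T} → ⟨ P ⟩ (S ⨾ T) ⟨ Q ⟩
           → Σ[ R ∈ Assn ] ⟨ P ⟩ S ⟨ R ⟩ × ⟨ R ⟩ T ⟨ Q ⟩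
  comp-inv (h-comp dS dT) = _ , dS , dT
  comp-inv (h-conseq P′⇒P d Q⇒Q′) with comp-inv d
  ... | R , dS , dT = R , weaken-pre P′⇒P dS , strengthen-post dT Q⇒Q′

  if-inv : ∀ {P Q B S T} → ⟨ P ⟩ (if B then S else T) ⟨ Q ⟩
         → ⟨ B →ₐ P ⟩ S ⟨ Q ⟩ × ⟨ ¬ₐ B →ₐ P ⟩ T ⟨ Q ⟩
  if-inv (h-if dS dT) = dS , dT
  if-inv (h-conseq P′⇒P d Q⇒Q′) with if-inv d
  ... | dS , dT = h-conseq (λ s f b → P′⇒P s (f b)) dS Q⇒Q′
                , h-conseq (λ s f b → P′⇒P s (f b)) dT Q⇒Q′

  while-inv : ∀ {P Q B S} → ⟨ P ⟩ (while B loop S) ⟨ Q ⟩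
            → Σ[ I ∈ Assn ] (I ⇒ P) × ⟨ B →ₐ I ⟩ S ⟨ I ⟩ × (Q ⇒ (¬ₐ B →ₐ I))
  while-inv (h-while d) = _ , (λ _ i → i) , d , (λ _ q → q)
  while-inv (h-conseq P′⇒P d Q⇒Q′) with while-inv d
  ... | I , I⇒P′ , dS , Q′⇒I =
    I , (λ s i → P′⇒P s (I⇒P′ s i)) , dS , (λ s q → Q′⇒I s (Q⇒Q′ s q))

  module PointwiseConnective
    (_⊕_ : Set → Set → Set)
    (map : ∀ {A A′ B B′ : Set} → (A → A′) → (B → B′) → A ⊕ B → A′ ⊕ B′)
    (distrib : ∀ {X A B : Set} → (X → A) ⊕ (X → B) → X → A ⊕ B)
    where

    _⊕ₐ_ : Assn → Assn → Assn
    (P ⊕ₐ Q) s = P s ⊕ Q s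

    ⊕ₐ-mono : ∀ {P₁ P₂ Q₁ Q₂} → P₁ ⇒ Q₁ → P₂ ⇒ Q₂ → (P₁ ⊕ₐ P₂) ⇒ (Q₁ ⊕ₐ Q₂)
    ⊕ₐ-mono f g s = map (f s) (g s)

    ⊕ₐ-admissible : ∀ C {P₁ P₂ Q₁ Q₂}
                  → ⟨ P₁ ⟩ C ⟨ Q₁ ⟩ → ⟨ P₂ ⟩ C ⟨ Q₂ ⟩
                  → ⟨ P₁ ⊕ₐ P₂ ⟩ C ⟨ Q₁ ⊕ₐ Q₂ ⟩
    ⊕ₐ-admissible skip d₁ d₂ =
      weaken-pre (⊕ₐ-mono (skip-inv d₁) (skip-inv d₂)) h-skip
    ⊕ₐ-admissible (V := E) d₁ d₂ =
      weaken-pre (⊕ₐ-mono (assign-inv d₁) (assign-inv d₂)) h-assign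
    ⊕ₐ-admissible (S ⨾ T) d₁ d₂ with comp-inv d₁ | comp-inv d₂
    ... | _ , dS₁ , dT₁ | _ , dS₂ , dT₂ =
      h-comp (⊕ₐ-admissible S dS₁ dS₂) (⊕ₐ-admissible T dT₁ dT₂)
    ⊕ₐ-admissible (if B then S else T) d₁ d₂ with if-inv d₁ | if-inv d₂
    ... | dS₁ , dT₁ | dS₂ , dT₂ =
      h-if (weaken-pre (λ _ → distrib) (⊕ₐ-admissible S dS₁ dS₂))
           (weaken-pre (λ _ → distrib) (⊕ₐ-admissible T dT₁ dT₂))
    ⊕ₐ-admissible (while B loop S) d₁ d₂ with while-inv d₁ | while-inv d₂
    ... | _ , I⇒P₁ , dS₁ , Q⇒I₁ | _ , I⇒P₂ , dS₂ , Q⇒I₂ =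
      h-conseq (⊕ₐ-mono I⇒P₁ I⇒P₂)
        (h-while (weaken-pre (λ _ → distrib) (⊕ₐ-admissible S dS₁ dS₂)))
        (λ s q → distrib (⊕ₐ-mono Q⇒I₁ Q⇒I₂ s q))

×-distrib-→ : ∀ {X A B : Set} → (X → A) × (X → B) → X → A × B
×-distrib-→ (f , g) x = f x , g x

⊎-distrib-→ : ∀ {X A B : Set} → (X → A) ⊎ (X → B) → X → A ⊎ B
⊎-distrib-→ (inj₁ f) x = inj₁ (f x)
⊎-distrib-→ (inj₂ g) x = inj₂ (g x)

mainTheorem9 : (Var : Set) (_≟_ : DecidableEquality Var) (Val : Set)
    → let open Lang Var _≟_ Val in
    (∀ (C : Cmd) (P₁ P₂ Q₁ Q₂ : Assn)
    → ⟨ P₁ ⟩ C ⟨ Q₁ ⟩ → ⟨ P₂ ⟩ C ⟨ Q₂ ⟩ → ⟨ P₁ ∧ₐ P₂ ⟩ C ⟨ Q₁ ∧ₐ Q₂ ⟩)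
    × (∀ (C : Cmd) (P₁ P₂ Q₁ Q₂ : Assn)
    → ⟨ P₁ ⟩ C ⟨ Q₁ ⟩ → ⟨ P₂ ⟩ C ⟨ Q₂ ⟩ → ⟨ P₁ ∨ₐ P₂ ⟩ C ⟨ Q₁ ∨ₐ Q₂ ⟩)
mainTheorem9 Var _≟_ Val =
    (λ C _ _ _ _ → Conjunction.⊕ₐ-admissible C)
  , (λ C _ _ _ _ → Disjunction.⊕ₐ-admissible C)
  where
  open Admissibility Var _≟_ Val
  module Conjunction = PointwiseConnective _×_ (λ f g → Product.map f g) ×-distrib-→
  module Disjunction = PointwiseConnective _⊎_ Sum.map ⊎-distrib-→
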